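{- Every finitely generated free semigroup is weakly homogeneous.
   Context: A semigroup (algebra) $H$ is weakly homogeneous if for every isomorphism $\varphi:A\to B$ between two finitely generated subsemigroups $A,B$ of $H$ such that $\varphi$ extends to an endomorphism of $H$ and $\varphi^{ -1}:B\to A$ also extends to an endomorphism of $H$, the map $\varphi$ extends to an automorphism of $H$. -}

module Defs where

open import Level using (Level; _⊔_; suc)
open import Data.Nat using (ℕ)
open import Data.Fin using (Fin)
open import Data.List using (List)
open import Data.List.NonEmpty using (List⁺; _⁺++⁺_)
open import Data.List.Membership.Propositional using (_∈_)
open import Data.Product using (Σ; _×_; ∃; ∃-syntax)
open import Relation.Binary.PropositionalEquality using (_≡_)

-- A semigroup (algebra) given by a carrier with a binary operation, equality
-- being propositional equality.  (Associativity is not needed to state the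
-- notions below; the concrete free semigroup is associative.)
module _ {a : Level} {H : Set a} (_·_ : H → H → H) where

  data ⟨_⟩ (gs : List H) : H → Set a where
    gen  : ∀ {x} → x ∈ gs → ⟨ gs ⟩ x
    prod : ∀ {x y} → ⟨ gs ⟩ x → ⟨ gs ⟩ y → ⟨ gs ⟩ (x · y)

  IsHom : (H → H) → Set a
  IsHom f = ∀ x y → f (x · y) ≡ f x · f y

  IsEndo : (H → H) → Set a
  IsEndo = IsHom

  IsAuto : (H → H) → Set a
  IsAuto f = IsHom f
           × (∀ x y → f x ≡ f y → x ≡ y)
           × (∀ y → ∃[ x ] f x ≡ y)

  -- φ (only its values on A matter) is an isomorphism of the
  -- subsemigroup A onto the subsemigroup B.
  IsIsoOnto : (A B : H → Set a) → (H → H) → Set a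
  IsIsoOnto A B φ =
      (∀ {x} → A x → B (φ x))
    × (∀ {x y} → A x → A y → φ (x · y) ≡ φ x · φ y)
    × (∀ {x y} → A x → A y → φ x ≡ φ y → x ≡ y)
    × (∀ {y} → B y → ∃[ x ] (A x × φ x ≡ y))

  -- A = ⟨ gs ⟩ and B = ⟨ hs ⟩ are arbitrary finitely
  -- generated subsemigroups; φ : A → B an isomorphism; φ extends to an
  -- endomorphism f; φ⁻¹ : B → A extends to an endomorphism g (i.e. g (φ a) = a
  -- for a ∈ A); then φ extends to an automorphism of H.
  WeaklyHomogeneous : Set a
  WeaklyHomogeneous =
    ∀ (gs hs : List H) (φ : H → H) →
      IsIsoOnto ⟨ gs ⟩ ⟨ hs ⟩ φ →
      (∃[ f ] (IsEndo f × (∀ {x} → ⟨ gs ⟩ x → f x ≡ φ x))) →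
      (∃[ g ] (IsEndo g × (∀ {x} → ⟨ gs ⟩ x → g (φ x) ≡ x))) →
      ∃[ α ] (IsAuto α × (∀ {x} → ⟨ gs ⟩ x → α x ≡ φ x))

FreeSemigroup : ℕ → Set
FreeSemigroup n = List⁺ (Fin n)

_·F_ : ∀ {n} → FreeSemigroup n → FreeSemigroup n → FreeSemigroup n
_·F_ = _⁺++⁺_

module Submission where

-- Let f and g be endomorphisms of the free semigroup on the letters Fin n
-- such that g ∘ f fixes every generator w of a finitely generated
-- subsemigroup A = ⟨ gs ⟩.  Endomorphisms never shorten words, so comparing
-- lengths in g (f w) = w shows that g ∘ f fixes every letter c occurring in
-- the generators, and then that f sends each such letter to a single letter
-- p c, with p injective on these letters.  An injection between finite sets
-- of letters extends to a permutation σ of Fin n, and renaming letters by σ is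
-- an automorphism of the free semigroup.  It agrees with f on the letters of
-- the generators, hence on the generators, hence on A, where f agrees with φ.

open import Defs
open import Data.Nat using (ℕ; suc; _+_; _≤_; z≤n; s≤s)
open import Data.Nat.Properties using (≤-trans; ≤-reflexive; m+n≮n; +-mono-≤; suc-injective)
open import Data.Fin using (Fin; _≟_)
open import Data.Fin.Permutation using (Permutation′; _⟨$⟩ʳ_; _⟨$⟩ˡ_; inverseˡ; inverseʳ; _∘ₚ_; transpose)
import Data.Fin.Permutation as Permutation
import Data.Fin.Permutation.Components as PermutationComponents
open import Data.List as List using (List; []; _∷_; concatMap)
open import Data.List.NonEmpty using (_∷_; _∷⁺_; [_]; head; length; toList; map)
open import Data.List.NonEmpty.Properties using (length-⁺++⁺; map-⁺++⁺; map-∘; map-cong; map-id)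
open import Data.List.Membership.Propositional using (_∈_; lose; find)
open import Data.List.Membership.Propositional.Properties using (∈-concatMap⁺; ∈-concatMap⁻)
open import Data.List.Relation.Unary.Any using (here; there)
open import Data.Product using (Σ; _×_; _,_; proj₁; proj₂; ∃-syntax)
open import Data.Empty using (⊥-elim)
open import Function using (_∘_; id)
open import Level using (Level)
open import Relation.Nullary using (yes; no; ¬_)
open import Relation.Binary.PropositionalEquality
  using (_≡_; refl; sym; trans; cong; cong₂; module ≡-Reasoning)
open ≡-Reasoning

module _ {a : Level} {H : Set a} {_·_ : H → H → H} where

  ∘-isHom : ∀ {f g : H → H} → IsHom _·_ f → IsHom _·_ g → IsHom _·_ (g ∘ f)
  ∘-isHom {f} {g} f-hom g-hom x y = trans (cong g (f-hom x y)) (g-hom (f x) (f y))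

  homs-agree-on-span : ∀ {f h : H → H} {gs : List H} → IsHom _·_ f → IsHom _·_ h →
                       (∀ {w} → w ∈ gs → f w ≡ h w) →
                       ∀ {x} → ⟨ _·_ ⟩ gs x → f x ≡ h x
  homs-agree-on-span f-hom h-hom agree (gen w∈gs) = agree w∈gs
  homs-agree-on-span {f} {h} f-hom h-hom agree (prod {x} {y} x∈ y∈) = begin
    f (x · y)   ≡⟨ f-hom x y ⟩
    f x · f y   ≡⟨ cong₂ _·_ (homs-agree-on-span f-hom h-hom agree x∈)
                             (homs-agree-on-span f-hom h-hom agree y∈) ⟩
    h x · h y   ≡⟨ h-hom x y ⟨
    h (x · y)   ∎

map-leftInverse : ∀ {A B : Set} {s : A → B} {t : B → A} → (∀ i → t (s i) ≡ i) →
                  ∀ w → map t (map s w) ≡ w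
map-leftInverse {s = s} {t} t∘s≗id w = begin
  map t (map s w)   ≡⟨ map-∘ w ⟨
  map (t ∘ s) w     ≡⟨ map-cong t∘s≗id w ⟩
  map id w          ≡⟨ map-id w ⟩
  w                 ∎

module _ {n : ℕ} where

  Word : Set
  Word = FreeSemigroup n

  length-pos : (w : Word) → 1 ≤ length w
  length-pos (_ ∷ _) = s≤s z≤n

  -- Endomorphisms never shorten words, since every letter is sent to a
  -- nonempty word.
  hom-nonshortening : ∀ {h : Word → Word} → IsHom _·F_ h → (w : Word) → length w ≤ length (h w)
  hom-nonshortening {h} h-hom (c ∷ cs) = go c cs
    where
    go : ∀ c cs → length (c ∷ cs) ≤ length (h (c ∷ cs))
    go c []       = length-pos (h [ c ])
    go c (d ∷ ds) = ≤-trans (+-mono-≤ (length-pos (h [ c ])) (go d ds)) (≤-reflexive (begin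
      length (h [ c ]) + length (h (d ∷ ds)) ≡⟨ length-⁺++⁺ (h [ c ]) (h (d ∷ ds)) ⟨
      length (h [ c ] ·F h (d ∷ ds))         ≡⟨ cong length (h-hom [ c ] (d ∷ ds)) ⟨
      length (h (c ∷ d ∷ ds))                ∎))

  split-first-letter : ∀ (X Y : Word) c v → length v ≤ length Y → X ·F Y ≡ c ∷⁺ v →
                       X ≡ [ c ] × Y ≡ v
  split-first-letter (x ∷ []) (y ∷ ys) c (d ∷ ds) _ refl = refl , refl
  split-first-letter (x ∷ x′ ∷ xs) Y c (d ∷ ds) v≤Y X·Y≡cv =
    ⊥-elim (m+n≮n (List.length xs) (length Y) (≤-trans (≤-reflexive lengths) v≤Y))
    where
    lengths : suc (List.length xs + length Y) ≡ length (d ∷ ds)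
    lengths = suc-injective (trans (sym (length-⁺++⁺ (x ∷ x′ ∷ xs) Y)) (cong length X·Y≡cv))

  short-word-is-letter : (w : Word) → length w ≤ 1 → w ≡ [ head w ]
  short-word-is-letter (c ∷ [])    _        = refl
  short-word-is-letter (c ∷ _ ∷ _) (s≤s ())

  -- An endomorphism fixing a word fixes each of its letters: in
  -- e [ c ] · e v = c ∷⁺ v the word e v is at least as long as v, which
  -- isolates the first letter.
  fixes-letters : ∀ {e : Word → Word} → IsHom _·F_ e → ∀ {w} → e w ≡ w →
                  ∀ {c} → c ∈ toList w → e [ c ] ≡ [ c ]
  fixes-letters {e} e-hom {c ∷ cs} = go c cs
    where
    peel : ∀ c d ds → e (c ∷ d ∷ ds) ≡ c ∷ d ∷ ds → e [ c ] ≡ [ c ] × e (d ∷ ds) ≡ d ∷ ds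
    peel c d ds fixed = split-first-letter (e [ c ]) (e (d ∷ ds)) c (d ∷ ds)
      (hom-nonshortening e-hom (d ∷ ds)) (trans (sym (e-hom [ c ] (d ∷ ds))) fixed)

    go : ∀ c cs → e (c ∷ cs) ≡ c ∷ cs → ∀ {b} → b ∈ c ∷ cs → e [ b ] ≡ [ b ]
    go c []       fixed (here refl) = fixed
    go c (d ∷ ds) fixed (here refl) = proj₁ (peel c d ds fixed)
    go c (d ∷ ds) fixed (there b∈)  = go d ds (proj₂ (peel c d ds fixed)) b∈

  retracted-letter-image : ∀ {f g : Word → Word} → IsHom _·F_ g →
                           ∀ {c} → g (f [ c ]) ≡ [ c ] → f [ c ] ≡ [ head (f [ c ]) ]
  retracted-letter-image {f} g-hom {c} gf[c]≡[c] = short-word-is-letter (f [ c ])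
    (≤-trans (hom-nonshortening g-hom (f [ c ])) (≤-reflexive (cong length gf[c]≡[c])))

  homs-agree-on-letters : ∀ {h k : Word → Word} → IsHom _·F_ h → IsHom _·F_ k → ∀ w →
                          (∀ {c} → c ∈ toList w → h [ c ] ≡ k [ c ]) → h w ≡ k w
  homs-agree-on-letters {h} {k} h-hom k-hom (c ∷ cs) = go c cs
    where
    go : ∀ c cs → (∀ {b} → b ∈ c ∷ cs → h [ b ] ≡ k [ b ]) → h (c ∷ cs) ≡ k (c ∷ cs)
    go c []       agree = agree (here refl)
    go c (d ∷ ds) agree = begin
      h ([ c ] ·F (d ∷ ds))      ≡⟨ h-hom [ c ] (d ∷ ds) ⟩
      h [ c ] ·F h (d ∷ ds)      ≡⟨ cong₂ _·F_ (agree (here refl)) (go d ds (agree ∘ there)) ⟩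
      k [ c ] ·F k (d ∷ ds)      ≡⟨ k-hom [ c ] (d ∷ ds) ⟨
      k ([ c ] ·F (d ∷ ds))      ∎

  letters : List Word → List (Fin n)
  letters = concatMap toList

  ∈-letters⁺ : ∀ {ws w c} → w ∈ ws → c ∈ toList w → c ∈ letters ws
  ∈-letters⁺ w∈ws c∈w = ∈-concatMap⁺ toList (lose w∈ws c∈w)

  ∈-letters⁻ : ∀ {ws c} → c ∈ letters ws → ∃[ w ] (w ∈ ws × c ∈ toList w)
  ∈-letters⁻ {ws} c∈ = find (∈-concatMap⁻ toList {xs = ws} c∈)

  transpose-hits : ∀ (i j : Fin n) → PermutationComponents.transpose i j i ≡ j
  transpose-hits i j with i ≟ i
  ... | yes _   = refl
  ... | no i≢i  = ⊥-elim (i≢i refl)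

  transpose-fixes : ∀ (i j k : Fin n) → ¬ k ≡ i → ¬ k ≡ j → PermutationComponents.transpose i j k ≡ k
  transpose-fixes i j k k≢i k≢j with k ≟ i
  ... | yes k≡i = ⊥-elim (k≢i k≡i)
  ... | no _ with k ≟ j
  ...   | yes k≡j = ⊥-elim (k≢j k≡j)
  ...   | no _    = refl

  permutation-injective : ∀ (σ : Permutation′ n) {x y} → σ ⟨$⟩ʳ x ≡ σ ⟨$⟩ʳ y → x ≡ y
  permutation-injective σ {x} {y} σx≡σy = begin
    x                      ≡⟨ inverseˡ σ ⟨
    σ ⟨$⟩ˡ (σ ⟨$⟩ʳ x)      ≡⟨ cong (σ ⟨$⟩ˡ_) σx≡σy ⟩
    σ ⟨$⟩ˡ (σ ⟨$⟩ʳ y)      ≡⟨ inverseˡ σ ⟩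
    y                      ∎

  InjectiveOn : (Fin n → Fin n) → List (Fin n) → Set
  InjectiveOn p xs = ∀ {x y} → x ∈ xs → y ∈ xs → p x ≡ p y → x ≡ y

  -- For x ∷ xs, compose a permutation σ′ extending p on xs
  -- with the transposition of σ′ x and p x: it moves x to p x and, by
  -- injectivity of σ′ and of p, leaves the values p y (y ≠ x) alone.
  extend-to-permutation : ∀ (p : Fin n → Fin n) xs → InjectiveOn p xs →
                          Σ (Permutation′ n) λ σ → ∀ {x} → x ∈ xs → σ ⟨$⟩ʳ x ≡ p x
  extend-to-permutation p []       _   = Permutation.id , λ ()
  extend-to-permutation p (x ∷ xs) inj = σ , agrees
    where
    extension : Σ (Permutation′ n) λ σ′ → ∀ {y} → y ∈ xs → σ′ ⟨$⟩ʳ y ≡ p y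
    extension = extend-to-permutation p xs (λ y∈ z∈ → inj (there y∈) (there z∈))

    σ′ σ : Permutation′ n
    σ′ = proj₁ extension
    σ  = σ′ ∘ₚ transpose (σ′ ⟨$⟩ʳ x) (p x)

    agrees : ∀ {y} → y ∈ x ∷ xs → σ ⟨$⟩ʳ y ≡ p y
    agrees (here refl) = transpose-hits (σ′ ⟨$⟩ʳ x) (p x)
    agrees {y} (there y∈xs) with y ≟ x
    ... | yes refl = transpose-hits (σ′ ⟨$⟩ʳ x) (p x)
    ... | no y≢x   = begin
      PermutationComponents.transpose (σ′ ⟨$⟩ʳ x) (p x) (σ′ ⟨$⟩ʳ y)
        ≡⟨ cong (PermutationComponents.transpose (σ′ ⟨$⟩ʳ x) (p x)) σ′y≡py ⟩
      PermutationComponents.transpose (σ′ ⟨$⟩ʳ x) (p x) (p y)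
        ≡⟨ transpose-fixes (σ′ ⟨$⟩ʳ x) (p x) (p y)
             (λ py≡σ′x → y≢x (permutation-injective σ′ (trans σ′y≡py py≡σ′x)))
             (λ py≡px → y≢x (inj (there y∈xs) (here refl) py≡px)) ⟩
      p y ∎
      where
      σ′y≡py : σ′ ⟨$⟩ʳ y ≡ p y
      σ′y≡py = proj₂ extension y∈xs

  rename : Permutation′ n → Word → Word
  rename σ = map (σ ⟨$⟩ʳ_)

  rename-isHom : ∀ σ → IsHom _·F_ (rename σ)
  rename-isHom σ = map-⁺++⁺ (σ ⟨$⟩ʳ_)

  rename-isAuto : ∀ σ → IsAuto _·F_ (rename σ)
  rename-isAuto σ = rename-isHom σ , injective , surjective
    where
    injective : ∀ x y → rename σ x ≡ rename σ y → x ≡ y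
    injective x y σx≡σy = begin
      x                                ≡⟨ map-leftInverse (λ _ → inverseˡ σ) x ⟨
      map (σ ⟨$⟩ˡ_) (rename σ x)       ≡⟨ cong (map (σ ⟨$⟩ˡ_)) σx≡σy ⟩
      map (σ ⟨$⟩ˡ_) (rename σ y)       ≡⟨ map-leftInverse (λ _ → inverseˡ σ) y ⟩
      y                                ∎

    surjective : ∀ y → ∃[ x ] rename σ x ≡ y
    surjective y = map (σ ⟨$⟩ˡ_) y , map-leftInverse (λ _ → inverseʳ σ) y

  retraction⇒renaming : ∀ {f g : Word → Word} → IsHom _·F_ f → IsHom _·F_ g →
                        ∀ gs → (∀ {w} → w ∈ gs → g (f w) ≡ w) →
                        Σ (Permutation′ n) λ σ → ∀ {w} → w ∈ gs → rename σ w ≡ f w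
  retraction⇒renaming {f} {g} f-hom g-hom gs gf-fixes-generators =
    σ , λ w∈gs → homs-agree-on-letters (rename-isHom σ) f-hom _
                   (λ c∈w → renames-letter (∈-letters⁺ w∈gs c∈w))
    where
    gf-fixes : ∀ {c} → c ∈ letters gs → g (f [ c ]) ≡ [ c ]
    gf-fixes c∈ with ∈-letters⁻ c∈
    ... | w , w∈gs , c∈w =
      fixes-letters {e = g ∘ f} (∘-isHom {_·_ = _·F_} {f = f} {g = g} f-hom g-hom)
                    (gf-fixes-generators w∈gs) c∈w

    p : Fin n → Fin n
    p c = head (f [ c ])

    f-letter : ∀ {c} → c ∈ letters gs → f [ c ] ≡ [ p c ]
    f-letter c∈ = retracted-letter-image {f = f} g-hom (gf-fixes c∈)

    p-injective : InjectiveOn p (letters gs)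
    p-injective {x} {y} x∈ y∈ px≡py = cong head (begin
      [ x ]         ≡⟨ gf-fixes x∈ ⟨
      g (f [ x ])   ≡⟨ cong g (f-letter x∈) ⟩
      g [ p x ]     ≡⟨ cong (g ∘ [_]) px≡py ⟩
      g [ p y ]     ≡⟨ cong g (f-letter y∈) ⟨
      g (f [ y ])   ≡⟨ gf-fixes y∈ ⟩
      [ y ]         ∎)

    extension : Σ (Permutation′ n) λ σ → ∀ {c} → c ∈ letters gs → σ ⟨$⟩ʳ c ≡ p c
    extension = extend-to-permutation p (letters gs) p-injective

    σ : Permutation′ n
    σ = proj₁ extension

    renames-letter : ∀ {c} → c ∈ letters gs → rename σ [ c ] ≡ f [ c ]
    renames-letter c∈ = trans (cong [_] (proj₂ extension c∈)) (sym (f-letter c∈))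

-- Only the two extension hypotheses are needed; g ∘ f fixes each generator
-- because f extends φ and g extends φ⁻¹.
lemma4p4 : (n : ℕ) → WeaklyHomogeneous (_·F_ {n})
lemma4p4 n gs _ _ _ (f , f-hom , f≈φ) (g , g-hom , gφ≈id) =
  rename σ , rename-isAuto σ ,
  λ x∈A → trans (homs-agree-on-span (rename-isHom σ) f-hom rename≈f x∈A) (f≈φ x∈A)
  where
  gf-fixes-generators : ∀ {w} → w ∈ gs → g (f w) ≡ w
  gf-fixes-generators w∈gs = trans (cong g (f≈φ (gen w∈gs))) (gφ≈id (gen w∈gs))

  letter-renaming : Σ (Permutation′ n) λ σ → ∀ {w} → w ∈ gs → rename σ w ≡ f w
  letter-renaming = retraction⇒renaming f-hom g-hom gs gf-fixes-generators

  σ : Permutation′ n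
  σ = proj₁ letter-renaming

  rename≈f : ∀ {w} → w ∈ gs → rename σ w ≡ f w
  rename≈f = proj₂ letter-renaming
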